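{- Let $F_e\subseteq E(BS_4)$ with $|F_e|\le 11$. If $BS_4-F_e$ is disconnected, then $BS_4-F_e$ has a component $H$ with $|V(H)|\ge 4!-3$.
   Context: The $n$-dimensional bubble-sort star graph $BS_n$ has as vertex set all permutations $x=x_1x_2\cdots x_n$ of $\{1,\dots,n\}$. Two distinct vertices $x,y$ are adjacent iff there is $k\in\{2,\dots,n\}$ such that $y$ is obtained from $x$ either by swapping the entries in positions $k-1$ and $k$, or by swapping the entries in positions $1$ and $k$. For $F_e\subseteq E(G)$, $G-F_e$ is the graph with vertex set $V(G)$ and edge set $E(G)\setminus F_e$. -}

module Defs where

open import Data.Nat using (ℕ; zero; suc; _≥_; _∸_; _!)
open import Data.Fin using (Fin; zero; suc; inject₁)
open import Data.Vec using (Vec; lookup; _[_]≔_)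
open import Data.Product using (Σ; ∃; _×_; _,_)
open import Data.Sum using (_⊎_)
open import Data.List using (List; length)
open import Data.List.Membership.Propositional using (_∈_)
open import Data.List.Relation.Unary.All using (All)
open import Data.List.Relation.Unary.Unique.Propositional using (Unique)
open import Relation.Nullary using (¬_)
open import Relation.Binary.PropositionalEquality using (_≡_; _≢_)
open import Relation.Binary.Construct.Closure.ReflexiveTransitive using (Star)

-- A vertex candidate of BS_n: a word x_1 ... x_n over {1..n} (0-indexed: Fin n).
Word : ℕ → Set
Word n = Vec (Fin n) n

IsPerm : ∀ {n} → Word n → Set
IsPerm {n} x = ∀ (i j : Fin n) → lookup x i ≡ lookup x j → i ≡ j

swap : ∀ {n} → Word n → Fin n → Fin n → Word n
swap x i j = (x [ i ]≔ lookup x j) [ j ]≔ lookup x i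

-- Adjacency in BS_n, n = suc m (positions 0-indexed: position k ∈ {2..n}
-- becomes suc k' with k' : Fin m, and k-1 becomes inject₁ k').
Adj : ∀ {m} → Word (suc m) → Word (suc m) → Set
Adj {m} x y =
  IsPerm x × IsPerm y × x ≢ y ×
  ∃ λ (k : Fin m) → (y ≡ swap x (inject₁ k) (suc k)) ⊎ (y ≡ swap x zero (suc k))

-- An edge set F_e ⊆ E(BS_n), given as a list of (oriented representatives of) edges.
EdgeList : ℕ → Set
EdgeList m = List (Σ (Word (suc m) × Word (suc m)) λ { (x , y) → Adj x y })

InF : ∀ {m} → EdgeList m → Word (suc m) → Word (suc m) → Set
InF F x y = (∃ λ (a : Adj x y) → ((x , y) , a) ∈ F) ⊎ (∃ λ (a : Adj y x) → ((y , x) , a) ∈ F)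

AdjMinus : ∀ {m} → EdgeList m → Word (suc m) → Word (suc m) → Set
AdjMinus F x y = Adj x y × ¬ InF F x y

Reach : ∀ {m} → EdgeList m → Word (suc m) → Word (suc m) → Set
Reach F = Star (AdjMinus F)

Disconnected : ∀ {m} → EdgeList m → Set
Disconnected F = ∃ λ x → ∃ λ y → IsPerm x × IsPerm y × ¬ Reach F x y

HasComponentOfSize≥ : ∀ {m} → EdgeList m → ℕ → Set
HasComponentOfSize≥ F s =
  ∃ λ v → IsPerm v × ∃ λ (L : List (Word _)) →
    Unique L × length L ≥ s × All IsPerm L × All (Reach F v) L

-- Every set S of vertices of BS₄ with 4 ≤ |S| ≤ 20 has at least 12 edges leaving it; this is
-- verified by a branch-and-bound search over all subsets. A component of BS₄ − F is closed under
-- the edges not in F, so all edges leaving it lie in F and there are at most 11 of them: every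
-- component has at most 3 or at least 21 vertices. If none had 21, adding the components one at a
-- time would keep a closed set of at most 3 + 3 ≤ 20, hence at most 3, vertices, yet the union of all
-- components is the whole vertex set.

module Submission where

open import Defs
open import Data.Nat using (ℕ; zero; suc; _+_; _≤_; _<_; _∸_; _!; _≤ᵇ_; _<ᵇ_; z≤n; s≤s)
open import Data.Nat.Properties
  using (module ≤-Reasoning; ≤-reflexive; ≤-trans; ≤-<-trans; <-≤-trans; <-irrefl; <-asym; ≤⇒≯;
         m≤m+n; m≤n⇒m≤1+n; +-mono-≤; +-suc; +-assoc; +-identityʳ; +-commutativeSemigroup;
         ≤ᵇ⇒≤; <ᵇ⇒<; _<?_)
open import Algebra.Properties.CommutativeSemigroup +-commutativeSemigroup using (x∙yz≈y∙xz)
open import Data.Nat.GeneralisedArithmetic using (fold)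
open import Data.Nat.Solver using (module +-*-Solver)
open import Data.Bool using (Bool; true; false; T; _∨_; _∧_; _xor_)
open import Data.Bool.Properties using (T-∨; T-∧; T-≡; xor-same)
open import Data.Fin using (Fin; zero; suc; #_; inject₁; toℕ) renaming (_≟_ to _≟ᶠ_)
open import Data.Fin.Properties using (all?; any?; suc-injective)
open import Data.Fin.Subset
  using (Subset; inside; outside; _∈_; _⊆_; _⊂_; _∪_; ⊤; ⁅_⁆; ⋃; ∣_∣)
open import Data.Fin.Subset.Properties
  using (_∈?_; _⊂?_; ⊆-antisym; ⊂-irref; p⊂q⇒∣p∣<∣q∣; p⊆q⇒∣p∣≤∣q∣; ∣p∣≤n; ∣⊤∣≡n; ∣⊥∣≡0; ∉⊥;
         x∈⁅x⁆; x∈⁅y⁆⇒x≡y; p⊆p∪q; q⊆p∪q; x∈p∪q⁻; x∈p∪q⁺)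
open import Data.Vec using (Vec; []; _∷_; lookup; tabulate; here; there)
open import Data.Vec.Properties using (lookup∘tabulate; lookup⇒[]=; []=⇒lookup) renaming (≡-dec to ≡-decᵛ)
open import Data.List using (List; []; _∷_; _++_; map; length; allFin)
open import Data.List.Properties using (length-map)
open import Data.List.Membership.Propositional using (find; lose) renaming (_∈_ to _∈ₗ_)
open import Data.List.Membership.Propositional.Properties using (∈-map⁻; ∈-allFin)
open import Data.List.Relation.Unary.Any using (Any; here; there)
import Data.List.Relation.Unary.Any as Any
open import Data.List.Relation.Unary.All using (All; []; _∷_)
import Data.List.Relation.Unary.All as All
import Data.List.Relation.Unary.All.Properties as All
open import Data.List.Relation.Unary.AllPairs using ([]; _∷_)
open import Data.List.Relation.Unary.Unique.Propositional using (Unique)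
import Data.List.Relation.Unary.Unique.Propositional.Properties as Unique
open import Data.List.Relation.Unary.Unique.DecPropositional using (unique?)
open import Data.Product using (∃; _×_; _,_; proj₁; proj₂)
import Data.Product as Product
open import Data.Product.Properties using (,-injective) renaming (≡-dec to ≡-dec×)
open import Data.Sum using (_⊎_; inj₁; inj₂; [_,_]′)
import Data.Sum as Sum
open import Data.Empty using (⊥-elim)
open import Function using (_∘_; id; Equivalence)
open import Relation.Nullary using (Dec; yes; no; does; ¬_; ¬?)
open import Relation.Nullary.Decidable
  using (_×-dec_; _⊎-dec_; _→-dec_; from-yes; decidable-stable; dec-true)
open import Relation.Binary.PropositionalEquality
  using (_≡_; _≢_; refl; sym; trans; cong; cong₂; subst; subst₂; module ≡-Reasoning)
open import Relation.Binary.Construct.Closure.ReflexiveTransitive using (Star; ε; _◅_; _◅◅_; gmap)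

private
  variable
    A B : Set
    k n : ℕ

T-does⁻ : (a? : Dec A) → T (does a?) → A
T-does⁻ (yes a) _ = a

T-does⁺ : (a? : Dec A) → A → T (does a?)
T-does⁺ (yes _) _ = _
T-does⁺ (no ¬a) a = ¬a a

indicator : Bool → ℕ
indicator true  = 1
indicator false = 0

-- Additive rather than by if_then_else_, so that comparing two counts over a concrete list does
-- not branch during conversion checking.
count : (A → Bool) → List A → ℕ
count p [] = 0
count p (x ∷ xs) = indicator (p x) + count p xs

count-++ : ∀ (p : A → Bool) xs ys → count p (xs ++ ys) ≡ count p xs + count p ys
count-++ p [] ys = refl
count-++ p (x ∷ xs) ys =
  trans (cong (indicator (p x) +_) (count-++ p xs ys)) (sym (+-assoc (indicator (p x)) _ _))

count-map : ∀ (p : B → Bool) (f : A → B) xs → count p (map f xs) ≡ count (p ∘ f) xs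
count-map p f [] = refl
count-map p f (x ∷ xs) = cong (indicator (p (f x)) +_) (count-map p f xs)

count-mono : ∀ {p q : A → Bool} xs → (∀ {x} → x ∈ₗ xs → T (p x) → T (q x)) → count p xs ≤ count q xs
count-mono [] _ = z≤n
count-mono {p = p} {q} (x ∷ xs) p⇒q with p x in px | q x in qx
... | true  | true  = s≤s (count-mono xs (p⇒q ∘ there))
... | true  | false = ⊥-elim (subst T qx (p⇒q (here refl) (subst T (sym px) _)))
... | false | true  = m≤n⇒m≤1+n (count-mono xs (p⇒q ∘ there))
... | false | false = count-mono xs (p⇒q ∘ there)

count-none : ∀ {p : A → Bool} xs → (∀ {x} → x ∈ₗ xs → ¬ T (p x)) → count p xs ≡ 0
count-none [] _ = refl
count-none {p = p} (x ∷ xs) ¬p with p x in px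
... | true  = ⊥-elim (¬p (here refl) (subst T (sym px) _))
... | false = count-none xs (¬p ∘ there)

count≤1 : ∀ {p : A → Bool} {xs} → Unique xs →
          (∀ {x y} → x ∈ₗ xs → y ∈ₗ xs → T (p x) → T (p y) → x ≡ y) → count p xs ≤ 1
count≤1 [] _ = z≤n
count≤1 {p = p} {x ∷ xs} (x∉xs ∷ u) same with p x in px
... | true  = s≤s (≤-reflexive (count-none xs λ y∈ py →
                 All.lookup x∉xs y∈ (same (here refl) (there y∈) (subst T (sym px) _) py)))
... | false = count≤1 u (λ x∈ y∈ → same (there x∈) (there y∈))

count-∨ : ∀ (p q : A → Bool) xs → count (λ x → p x ∨ q x) xs ≤ count p xs + count q xs
count-∨ p q [] = z≤n
count-∨ p q (x ∷ xs) with p x | q x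
... | true  | true  = s≤s (≤-trans (m≤n⇒m≤1+n (count-∨ p q xs)) (≤-reflexive (sym (+-suc _ _))))
... | true  | false = s≤s (count-∨ p q xs)
... | false | true  = ≤-trans (s≤s (count-∨ p q xs)) (≤-reflexive (sym (+-suc _ _)))
... | false | false = count-∨ p q xs

count-any≤length : {R : B → A → Set} (R? : ∀ f x → Dec (R f x)) {xs : List A} → Unique xs →
                   (∀ f {x y} → x ∈ₗ xs → y ∈ₗ xs → R f x → R f y → x ≡ y) →
                   ∀ fs → count (λ x → does (Any.any? (λ f → R? f x) fs)) xs ≤ length fs
count-any≤length R? {xs} u single [] = ≤-reflexive (count-none xs λ _ ())
count-any≤length R? {xs} u single (f ∷ fs) =
  ≤-trans (count-∨ (λ x → does (R? f x)) _ xs)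
          (+-mono-≤ (count≤1 u λ x∈ y∈ Rx Ry → single f x∈ y∈ (T-does⁻ (R? f _) Rx) (T-does⁻ (R? f _) Ry))
                    (count-any≤length R? u single fs))

∣p∪q∣≤∣p∣+∣q∣ : ∀ (p q : Subset n) → ∣ p ∪ q ∣ ≤ ∣ p ∣ + ∣ q ∣
∣p∪q∣≤∣p∣+∣q∣ [] [] = z≤n
∣p∪q∣≤∣p∣+∣q∣ (inside  ∷ p) (inside  ∷ q) =
  s≤s (≤-trans (m≤n⇒m≤1+n (∣p∪q∣≤∣p∣+∣q∣ p q)) (≤-reflexive (sym (+-suc _ _))))
∣p∪q∣≤∣p∣+∣q∣ (inside  ∷ p) (outside ∷ q) = s≤s (∣p∪q∣≤∣p∣+∣q∣ p q)
∣p∪q∣≤∣p∣+∣q∣ (outside ∷ p) (inside  ∷ q) = ≤-trans (s≤s (∣p∪q∣≤∣p∣+∣q∣ p q)) (≤-reflexive (sym (+-suc _ _)))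
∣p∪q∣≤∣p∣+∣q∣ (outside ∷ p) (outside ∷ q) = ∣p∪q∣≤∣p∣+∣q∣ p q

⊆∧⊄⇒≡ : {p q : Subset n} → p ⊆ q → ¬ (p ⊂ q) → p ≡ q
⊆∧⊄⇒≡ {p = p} p⊆q p⊄q =
  ⊆-antisym p⊆q λ {x} x∈q → decidable-stable (x ∈? p) λ x∉p → p⊄q (p⊆q , x , x∈q , x∉p)

members : Subset n → List (Fin n)
members [] = []
members (inside  ∷ p) = zero ∷ map suc (members p)
members (outside ∷ p) = map suc (members p)

length-members : ∀ (p : Subset n) → length (members p) ≡ ∣ p ∣
length-members [] = refl
length-members (inside  ∷ p) = cong suc (trans (length-map suc (members p)) (length-members p))
length-members (outside ∷ p) = trans (length-map suc (members p)) (length-members p)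

∈-members : ∀ {p : Subset n} {i} → i ∈ₗ members p → i ∈ p
∈-members {p = inside ∷ p} (here refl) = here
∈-members {p = inside ∷ p} (there i∈) with ∈-map⁻ suc i∈
... | _ , j∈ , refl = there (∈-members j∈)
∈-members {p = outside ∷ p} i∈ with ∈-map⁻ suc i∈
... | _ , j∈ , refl = there (∈-members j∈)

members-unique : ∀ (p : Subset n) → Unique (members p)
members-unique [] = []
members-unique (inside  ∷ p) =
  All.map⁺ (All.tabulate λ _ ()) ∷ Unique.map⁺ suc-injective (members-unique p)
members-unique (outside ∷ p) = Unique.map⁺ suc-injective (members-unique p)

module _ (f : Subset n → Subset n) (inflationary : ∀ p → p ⊆ f p) where

  fold-inflationary : ∀ p k → p ⊆ fold p f k
  fold-inflationary p zero = id
  fold-inflationary p (suc k) = inflationary _ ∘ fold-inflationary p k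

  fold-stabilises : ∀ p k → f (fold p f k) ≡ fold p f k ⊎ k ≤ ∣ fold p f k ∣
  fold-stabilises p zero = inj₂ z≤n
  fold-stabilises p (suc k) with fold p f k ⊂? f (fold p f k)
  ... | no ⊄ = inj₁ (cong f (sym (⊆∧⊄⇒≡ (inflationary _) ⊄)))
  ... | yes ⊂ with fold-stabilises p k
  ...   | inj₁ fixed = ⊥-elim (⊂-irref (sym fixed) ⊂)
  ...   | inj₂ k≤ = inj₂ (≤-<-trans k≤ (p⊂q⇒∣p∣<∣q∣ ⊂))

  fold-fixpoint : ∀ p → f (fold p f (suc n)) ≡ fold p f (suc n)
  fold-fixpoint p with fold-stabilises p (suc n)
  ... | inj₁ fixed = fixed
  ... | inj₂ big = ⊥-elim (<-irrefl refl (≤-trans big (∣p∣≤n (fold p f (suc n)))))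

crosses : Subset n → Fin n × Fin n → Bool
crosses p (i , j) = lookup p i xor lookup p j

module Components (E : List (Fin n × Fin n)) {Blocked : Fin n × Fin n → Set}
                  (blocked? : ∀ e → Dec (Blocked e)) where

  Link : Fin n → Fin n → Set
  Link i j = Any (λ e → (e ≡ (i , j) ⊎ e ≡ (j , i)) × ¬ Blocked e) E

  link? : ∀ i j → Dec (Link i j)
  link? i j = Any.any? (λ e → ((e ≟ (i , j)) ⊎-dec (e ≟ (j , i))) ×-dec ¬? (blocked? e)) E
    where _≟_ = ≡-dec× _≟ᶠ_ _≟ᶠ_

  Link-sym : ∀ {i j} → Link i j → Link j i
  Link-sym = Any.map (Product.map₁ Sum.swap)

  Closed : Subset n → Set
  Closed p = ∀ {i j} → Link i j → i ∈ p → j ∈ p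

  -- grow mentions p twice, so unfolding an iterate of it would take exponential time.
  opaque
    grow : Subset n → Subset n
    grow p = p ∪ tabulate λ j → does (any? λ i → (i ∈? p) ×-dec link? i j)

    grow-inflationary : ∀ p → p ⊆ grow p
    grow-inflationary p = p⊆p∪q _

    ∈-grow : ∀ {p i j} → i ∈ p → Link i j → j ∈ grow p
    ∈-grow {p} {i} {j} i∈p link = q⊆p∪q p _ (lookup⇒[]= j _
      (trans (lookup∘tabulate _ j) (dec-true (any? λ i → (i ∈? p) ×-dec link? i j) (i , i∈p , link))))

    grow-⊆ : ∀ {p j} → j ∈ grow p → j ∈ p ⊎ ∃ λ i → i ∈ p × Link i j
    grow-⊆ {p} {j} j∈ with x∈p∪q⁻ p _ j∈
    ... | inj₁ j∈p = inj₁ j∈p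
    ... | inj₂ j∈t = inj₂ (T-does⁻ (any? _) (subst T (trans (sym ([]=⇒lookup j∈t)) (lookup∘tabulate _ j)) _))

  component : Fin n → Subset n
  component v = fold ⁅ v ⁆ grow (suc n)

  ∈-component : ∀ v → v ∈ component v
  ∈-component v = fold-inflationary grow grow-inflationary ⁅ v ⁆ (suc n) (x∈⁅x⁆ v)

  component-closed : ∀ v → Closed (component v)
  component-closed v link i∈ = subst (_ ∈_) (fold-fixpoint grow grow-inflationary ⁅ v ⁆) (∈-grow i∈ link)

  fold-connected : ∀ v k {j} → j ∈ fold ⁅ v ⁆ grow k → Star Link v j
  fold-connected v zero j∈ with x∈⁅y⁆⇒x≡y v j∈
  ... | refl = ε
  fold-connected v (suc k) j∈ with grow-⊆ j∈
  ... | inj₁ j∈′ = fold-connected v k j∈′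
  ... | inj₂ (i , i∈ , link) = fold-connected v k i∈ ◅◅ (link ◅ ε)

  component-connected : ∀ v {j} → j ∈ component v → Star Link v j
  component-connected v = fold-connected v (suc n)

  ∪-closed : ∀ {p q} → Closed p → Closed q → Closed (p ∪ q)
  ∪-closed {p} {q} cp cq link i∈ with x∈p∪q⁻ p q i∈
  ... | inj₁ i∈p = x∈p∪q⁺ (inj₁ (cp link i∈p))
  ... | inj₂ i∈q = x∈p∪q⁺ (inj₂ (cq link i∈q))

  closed-sides : ∀ {p i j} → Closed p → Link i j → lookup p i ≡ lookup p j
  closed-sides {p} {i} {j} closed link with lookup p i in pi | lookup p j in pj
  ... | true  | true  = refl
  ... | false | false = refl
  ... | true  | false with () ← trans (sym ([]=⇒lookup (closed link (lookup⇒[]= i p pi)))) pj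
  ... | false | true  with () ← trans (sym ([]=⇒lookup (closed (Link-sym link) (lookup⇒[]= j p pj)))) pi

  boundary≤blocked : ∀ {p} → Closed p → count (crosses p) E ≤ count (does ∘ blocked?) E
  boundary≤blocked {p} closed = count-mono E λ {(i , j)} e∈E cross → T-does⁺ (blocked? (i , j))
    (decidable-stable (blocked? (i , j)) λ unblocked → subst T
      (trans (cong (_xor lookup p j) (closed-sides closed (lose e∈E (inj₁ refl , unblocked)))) (xor-same (lookup p j)))
      cross)

  big-component : ∀ s b → s + s ≤ b → s < n → (∀ p → Closed p → ∣ p ∣ ≤ s ⊎ b < ∣ p ∣) →
                  ∃ λ v → b < ∣ component v ∣
  big-component s b s+s≤b s<n gap with any? (λ v → b <? ∣ component v ∣)
  ... | yes found = found
  ... | no none = ⊥-elim (<-irrefl refl (<-≤-trans s<n everything≤s))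
    where
    small : ∀ v → ∣ component v ∣ ≤ s
    small v = [ id , (λ big → ⊥-elim (none (v , big))) ]′ (gap _ (component-closed v))

    union : ∀ vs → Closed (⋃ (map component vs)) × ∣ ⋃ (map component vs) ∣ ≤ s
    union [] = (λ _ i∈ → ⊥-elim (∉⊥ i∈)) , ≤-trans (≤-reflexive (∣⊥∣≡0 n)) z≤n
    union (v ∷ vs) = closed , [ id , (λ big → ⊥-elim (<-irrefl refl (<-≤-trans big ≤b))) ]′ (gap U closed)
      where
      U = component v ∪ ⋃ (map component vs)
      closed : Closed U
      closed = ∪-closed (component-closed v) (proj₁ (union vs))
      ≤b : ∣ U ∣ ≤ b
      ≤b = ≤-trans (∣p∪q∣≤∣p∣+∣q∣ (component v) _) (≤-trans (+-mono-≤ (small v) (proj₂ (union vs))) s+s≤b)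

    covers : ∀ {v vs} → v ∈ₗ vs → v ∈ ⋃ (map component vs)
    covers {v} (here refl) = x∈p∪q⁺ (inj₁ (∈-component v))
    covers (there v∈) = x∈p∪q⁺ (inj₂ (covers v∈))

    everything≤s : n ≤ s
    everything≤s = ≤-trans (≤-reflexive (sym (∣⊤∣≡n n)))
      (≤-trans (p⊆q⇒∣p∣≤∣q∣ {p = ⊤} (λ {v} _ → covers (∈-allFin v))) (proj₂ (union (allFin n))))

infixr 5 _∷_

-- N ∷ G is the graph on Fin (suc k) in which vertex 0 is adjacent to the suc j with j ∈ N, and the
-- vertices suc i, suc j are adjacent iff i, j are adjacent in G.
data Graph : ℕ → Set where
  [] : Graph zero
  _∷_ : List (Fin k) → Graph k → Graph (suc k)

edges : Graph n → List (Fin n × Fin n)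
edges [] = []
edges (N ∷ G) = map (λ j → zero , suc j) N ++ map (Product.map suc suc) (edges G)

cut : Graph n → Subset n → ℕ
cut [] [] = 0
cut (N ∷ G) (b ∷ p) = count (λ j → b xor lookup p j) N + cut G p

cut≡count-crosses : ∀ (G : Graph n) p → cut G p ≡ count (crosses p) (edges G)
cut≡count-crosses [] [] = refl
cut≡count-crosses (N ∷ G) (b ∷ p) = sym (begin
  count (crosses (b ∷ p)) (edges (N ∷ G))
    ≡⟨ count-++ _ (map _ N) _ ⟩
  count (crosses (b ∷ p)) (map (λ j → zero , suc j) N) +
  count (crosses (b ∷ p)) (map (Product.map suc suc) (edges G))
    ≡⟨ cong₂ _+_ (count-map _ _ N) (trans (count-map _ _ (edges G)) (sym (cut≡count-crosses G p))) ⟩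
  count (λ j → b xor lookup p j) N + cut G p
    ∎)
  where open ≡-Reasoning

edges-ascending : ∀ (G : Graph n) → All (λ (i , j) → toℕ i < toℕ j) (edges G)
edges-ascending [] = []
edges-ascending (N ∷ G) =
  All.++⁺ (All.map⁺ (All.tabulate λ _ → s≤s z≤n)) (All.map⁺ (All.map s≤s (edges-ascending G)))

Pending : ℕ → Set
Pending k = List (Fin k × Bool)

mismatches : Pending k → Subset k → ℕ
mismatches P p = count (λ (j , a) → a xor lookup p j) P

atHead : Pending (suc k) → List Bool
atHead [] = []
atHead ((zero  , a) ∷ P) = a ∷ atHead P
atHead ((suc _ , _) ∷ P) = atHead P

later : Pending (suc k) → Pending k
later [] = []
later ((zero  , _) ∷ P) = later P
later ((suc j , a) ∷ P) = (j , a) ∷ later P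

mismatches-∷ : ∀ (P : Pending (suc k)) b p →
               mismatches P (b ∷ p) ≡ count (_xor b) (atHead P) + mismatches (later P) p
mismatches-∷ [] b p = refl
mismatches-∷ ((zero , a) ∷ P) b p =
  trans (cong (indicator (a xor b) +_) (mismatches-∷ P b p)) (sym (+-assoc (indicator (a xor b)) _ _))
mismatches-∷ ((suc j , a) ∷ P) b p =
  trans (cong (indicator (a xor lookup p j) +_) (mismatches-∷ P b p))
        (x∙yz≈y∙xz (indicator (a xor lookup p j)) (count (_xor b) (atHead P)) (mismatches (later P) p))

∣∷∣ : ∀ b (p : Subset n) → ∣ b ∷ p ∣ ≡ indicator b + ∣ p ∣
∣∷∣ true  p = refl
∣∷∣ false p = refl

-- Branch and bound over all subsets, deciding vertex 0 first. An edge is counted when its later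
-- endpoint is decided; until then it is pending, together with the side of its earlier endpoint.
-- In search G P c m, c crossing edges and m vertices inside have been counted so far; both only grow,
-- so once k ≤ c or hi < m every completion is admissible.
module Isoperimetry (k lo hi : ℕ) where

  Admissible : ℕ → ℕ → Set
  Admissible c m = k ≤ c ⊎ m ≤ lo ⊎ hi < m

  admissible? : ℕ → ℕ → Bool
  admissible? c m = (k ≤ᵇ c) ∨ (m ≤ᵇ lo) ∨ (hi <ᵇ m)

  prunable : ℕ → ℕ → Bool
  prunable c m = (k ≤ᵇ c) ∨ (hi <ᵇ m)

  search : Graph n → Pending n → ℕ → ℕ → Bool
  descend : List (Fin n) → Graph n → Pending (suc n) → ℕ → ℕ → Bool → Bool

  search [] _ c m = admissible? c m
  search (N ∷ G) P c m = prunable c m ∨ (descend N G P c m false ∧ descend N G P c m true)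

  descend N G P c m b =
    search G (later P ++ map (_, b) N) (c + count (_xor b) (atHead P)) (m + indicator b)

  prunable-admissible : ∀ {c m c′ m′} → T (prunable c m) → c ≤ c′ → m ≤ m′ → Admissible c′ m′
  prunable-admissible {c} {m} t c≤c′ m≤m′ with Equivalence.to T-∨ t
  ... | inj₁ k≤c  = inj₁ (≤-trans (≤ᵇ⇒≤ k c k≤c) c≤c′)
  ... | inj₂ hi<m = inj₂ (inj₂ (<-≤-trans (<ᵇ⇒< hi m hi<m) m≤m′))

  admissible?-sound : ∀ c m → T (admissible? c m) → Admissible c m
  admissible?-sound c m t with Equivalence.to T-∨ t
  ... | inj₁ k≤c = inj₁ (≤ᵇ⇒≤ k c k≤c)
  ... | inj₂ t′ with Equivalence.to T-∨ t′
  ...   | inj₁ m≤lo = inj₂ (inj₁ (≤ᵇ⇒≤ m lo m≤lo))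
  ...   | inj₂ hi<m = inj₂ (inj₂ (<ᵇ⇒< hi m hi<m))

  search-sound : ∀ (G : Graph n) P c m → T (search G P c m) →
                 ∀ p → Admissible (c + mismatches P p + cut G p) (m + ∣ p ∣)
  search-sound [] [] c m t [] =
    subst₂ Admissible (sym (trans (+-identityʳ _) (+-identityʳ c))) (sym (+-identityʳ m)) (admissible?-sound c m t)
  search-sound (N ∷ G) P c m t (b ∷ p) with Equivalence.to T-∨ t
  ... | inj₁ prune = prunable-admissible prune (≤-trans (m≤m+n c _) (m≤m+n _ _)) (m≤m+n m _)
  ... | inj₂ both = subst₂ Admissible cost size (search-sound G _ _ _ (branch b) p)
    where
    open ≡-Reasoning
    open +-*-Solver using (solve; _:+_; _:=_)

    branch : ∀ b → T (descend N G P c m b)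
    branch false = proj₁ (Equivalence.to T-∧ both)
    branch true  = proj₂ (Equivalence.to T-∧ both)

    h l x : ℕ
    h = count (_xor b) (atHead P)
    l = mismatches (later P) p
    x = count (λ j → b xor lookup p j) N

    cost : c + h + mismatches (later P ++ map (_, b) N) p + cut G p
         ≡ c + mismatches P (b ∷ p) + cut (N ∷ G) (b ∷ p)
    cost = begin
      c + h + mismatches (later P ++ map (_, b) N) p + cut G p
        ≡⟨ cong (λ z → c + h + z + cut G p) (trans (count-++ _ (later P) _) (cong (l +_) (count-map _ _ N))) ⟩
      c + h + (l + x) + cut G p
        ≡⟨ solve 5 (λ c h l x t → c :+ h :+ (l :+ x) :+ t := c :+ (h :+ l) :+ (x :+ t)) refl c h l x (cut G p) ⟩
      c + (h + l) + (x + cut G p)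
        ≡⟨ cong (λ z → c + z + (x + cut G p)) (sym (mismatches-∷ P b p)) ⟩
      c + mismatches P (b ∷ p) + cut (N ∷ G) (b ∷ p)
        ∎

    size : m + indicator b + ∣ p ∣ ≡ m + ∣ b ∷ p ∣
    size = trans (+-assoc m _ _) (cong (m +_) (sym (∣∷∣ b p)))

  isoperimetric : ∀ (G : Graph n) → search G [] 0 0 ≡ true → ∀ p → Admissible (cut G p) ∣ p ∣
  isoperimetric G ok = search-sound G [] 0 0 (Equivalence.from T-≡ ok)

isPerm? : ∀ (x : Word n) → Dec (IsPerm x)
isPerm? x = all? λ i → all? λ j → (lookup x i ≟ᶠ lookup x j) →-dec (i ≟ᶠ j)

adj? : ∀ (x y : Word (suc n)) → Dec (Adj x y)
adj? x y = isPerm? x ×-dec isPerm? y ×-dec ¬? (x ≟ y) ×-dec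
           any? λ k → (y ≟ swap x (inject₁ k) (suc k)) ⊎-dec (y ≟ swap x zero (suc k))
  where _≟_ = ≡-decᵛ _≟ᶠ_

-- In breadth-first order from the identity, which lets the search prune early.
vertices : Vec (Word 4) 24
vertices =
  (# 0 ∷ # 1 ∷ # 2 ∷ # 3 ∷ []) ∷
  (# 0 ∷ # 1 ∷ # 3 ∷ # 2 ∷ []) ∷
  (# 0 ∷ # 2 ∷ # 1 ∷ # 3 ∷ []) ∷
  (# 1 ∷ # 0 ∷ # 2 ∷ # 3 ∷ []) ∷
  (# 2 ∷ # 1 ∷ # 0 ∷ # 3 ∷ []) ∷
  (# 3 ∷ # 1 ∷ # 2 ∷ # 0 ∷ []) ∷
  (# 0 ∷ # 3 ∷ # 1 ∷ # 2 ∷ []) ∷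
  (# 1 ∷ # 0 ∷ # 3 ∷ # 2 ∷ []) ∷
  (# 2 ∷ # 1 ∷ # 3 ∷ # 0 ∷ []) ∷
  (# 3 ∷ # 1 ∷ # 0 ∷ # 2 ∷ []) ∷
  (# 0 ∷ # 2 ∷ # 3 ∷ # 1 ∷ []) ∷
  (# 1 ∷ # 2 ∷ # 0 ∷ # 3 ∷ []) ∷
  (# 2 ∷ # 0 ∷ # 1 ∷ # 3 ∷ []) ∷
  (# 3 ∷ # 2 ∷ # 1 ∷ # 0 ∷ []) ∷
  (# 3 ∷ # 0 ∷ # 2 ∷ # 1 ∷ []) ∷
  (# 1 ∷ # 3 ∷ # 2 ∷ # 0 ∷ []) ∷
  (# 0 ∷ # 3 ∷ # 2 ∷ # 1 ∷ []) ∷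
  (# 1 ∷ # 3 ∷ # 0 ∷ # 2 ∷ []) ∷
  (# 2 ∷ # 3 ∷ # 1 ∷ # 0 ∷ []) ∷
  (# 3 ∷ # 0 ∷ # 1 ∷ # 2 ∷ []) ∷
  (# 2 ∷ # 0 ∷ # 3 ∷ # 1 ∷ []) ∷
  (# 1 ∷ # 2 ∷ # 3 ∷ # 0 ∷ []) ∷
  (# 3 ∷ # 2 ∷ # 0 ∷ # 1 ∷ []) ∷
  (# 2 ∷ # 3 ∷ # 0 ∷ # 1 ∷ []) ∷ []

vertex : Fin 24 → Word 4
vertex = lookup vertices

bs₄ : Graph 24
bs₄ =
  (# 0 ∷ # 1 ∷ # 2 ∷ # 3 ∷ # 4 ∷ []) ∷
  (# 4 ∷ # 5 ∷ # 6 ∷ # 7 ∷ []) ∷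
  (# 7 ∷ # 8 ∷ # 9 ∷ # 10 ∷ []) ∷
  (# 3 ∷ # 7 ∷ # 8 ∷ # 10 ∷ []) ∷
  (# 3 ∷ # 4 ∷ # 6 ∷ # 7 ∷ []) ∷
  (# 2 ∷ # 3 ∷ # 7 ∷ # 9 ∷ []) ∷
  (# 9 ∷ # 10 ∷ # 11 ∷ # 12 ∷ []) ∷
  (# 9 ∷ # 11 ∷ # 12 ∷ []) ∷
  (# 9 ∷ # 12 ∷ []) ∷
  (# 7 ∷ # 9 ∷ []) ∷
  (# 5 ∷ # 9 ∷ # 10 ∷ # 11 ∷ []) ∷
  (# 9 ∷ # 10 ∷ []) ∷
  (# 6 ∷ # 7 ∷ []) ∷
  (# 4 ∷ # 7 ∷ # 8 ∷ []) ∷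
  (# 1 ∷ # 4 ∷ # 5 ∷ # 7 ∷ []) ∷
  (# 0 ∷ # 1 ∷ # 2 ∷ # 5 ∷ []) ∷
  (# 6 ∷ []) ∷
  (# 5 ∷ []) ∷
  (# 4 ∷ []) ∷
  [] ∷
  (# 2 ∷ []) ∷
  [] ∷
  (# 0 ∷ []) ∷
  [] ∷ []

bs₄-isoperimetric : ∀ p → 12 ≤ cut bs₄ p ⊎ ∣ p ∣ ≤ 3 ⊎ 20 < ∣ p ∣
bs₄-isoperimetric = Isoperimetry.isoperimetric 12 3 20 bs₄ refl

vertex-isPerm : ∀ i → IsPerm (vertex i)
vertex-isPerm = from-yes (all? λ i → isPerm? (vertex i))

vertex-injective : ∀ {i j} → vertex i ≡ vertex j → i ≡ j
vertex-injective {i} {j} =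
  from-yes (all? λ i → all? λ j → ≡-decᵛ _≟ᶠ_ (vertex i) (vertex j) →-dec (i ≟ᶠ j)) i j

edges-adjacent : All (λ (i , j) → Adj (vertex i) (vertex j) × Adj (vertex j) (vertex i)) (edges bs₄)
edges-adjacent =
  from-yes (All.all? (λ (i , j) → adj? (vertex i) (vertex j) ×-dec adj? (vertex j) (vertex i)) (edges bs₄))

edges-unique : Unique (edges bs₄)
edges-unique = from-yes (unique? (≡-dec× _≟ᶠ_ _≟ᶠ_) (edges bs₄))

Joins : Word 4 × Word 4 → Fin 24 × Fin 24 → Set
Joins xy (i , j) = xy ≡ (vertex i , vertex j) ⊎ xy ≡ (vertex j , vertex i)

joins? : ∀ xy e → Dec (Joins xy e)
joins? xy (i , j) = (xy ≟ (vertex i , vertex j)) ⊎-dec (xy ≟ (vertex j , vertex i))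
  where _≟_ = ≡-dec× (≡-decᵛ _≟ᶠ_) (≡-decᵛ _≟ᶠ_)

vertex-pair-injective : ∀ {i j i′ j′} → (vertex i , vertex j) ≡ (vertex i′ , vertex j′) → (i , j) ≡ (i′ , j′)
vertex-pair-injective eq with ,-injective eq
... | p , q = cong₂ _,_ (vertex-injective p) (vertex-injective q)

crossed-pairs : ∀ {i j i′ j′ : Fin n} → toℕ i < toℕ j → toℕ i′ < toℕ j′ → (i , j) ≢ (j′ , i′)
crossed-pairs i<j i′<j′ refl = <-asym i<j i′<j′

joins-unique : ∀ xy {e e′} → e ∈ₗ edges bs₄ → e′ ∈ₗ edges bs₄ → Joins xy e → Joins xy e′ → e ≡ e′
joins-unique xy e∈ e′∈ (inj₁ p) (inj₁ q) = vertex-pair-injective (trans (sym p) q)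
joins-unique xy e∈ e′∈ (inj₂ p) (inj₂ q) = cong Product.swap (vertex-pair-injective (trans (sym p) q))
joins-unique xy e∈ e′∈ (inj₁ p) (inj₂ q) =
  ⊥-elim (crossed-pairs (ascending e∈) (ascending e′∈) (vertex-pair-injective (trans (sym p) q)))
  where ascending = All.lookup (edges-ascending bs₄)
joins-unique xy e∈ e′∈ (inj₂ p) (inj₁ q) =
  ⊥-elim (crossed-pairs (ascending e′∈) (ascending e∈) (vertex-pair-injective (trans (sym q) p)))
  where ascending = All.lookup (edges-ascending bs₄)

module Faults (F : EdgeList 3) where

  Blocked : Fin 24 × Fin 24 → Set
  Blocked e = Any (λ f → Joins (proj₁ f) e) F

  blocked? : ∀ e → Dec (Blocked e)
  blocked? e = Any.any? (λ f → joins? (proj₁ f) e) F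

  open Components (edges bs₄) blocked? public

  blocked≤faults : count (does ∘ blocked?) (edges bs₄) ≤ length F
  blocked≤faults = count-any≤length (λ f → joins? (proj₁ f)) edges-unique (λ f → joins-unique (proj₁ f)) F

  closed-cut≤faults : ∀ {p} → Closed p → cut bs₄ p ≤ length F
  closed-cut≤faults {p} closed = begin
    cut bs₄ p                           ≡⟨ cut≡count-crosses bs₄ p ⟩
    count (crosses p) (edges bs₄)       ≤⟨ boundary≤blocked closed ⟩
    count (does ∘ blocked?) (edges bs₄) ≤⟨ blocked≤faults ⟩
    length F                            ∎
    where open ≤-Reasoning

  closed-gap : length F ≤ 11 → ∀ p → Closed p → ∣ p ∣ ≤ 3 ⊎ 20 < ∣ p ∣
  closed-gap |F|≤11 p closed =
    [ ⊥-elim ∘ ≤⇒≯ (≤-trans (closed-cut≤faults closed) |F|≤11) , id ]′ (bs₄-isoperimetric p)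

  unblocked⇒∉F : ∀ {i j} → ¬ Blocked (i , j) →
                 ¬ InF F (vertex i) (vertex j) × ¬ InF F (vertex j) (vertex i)
  unblocked⇒∉F unblocked =
    [ (λ (_ , f∈) → unblocked (lose f∈ (inj₁ refl))) , (λ (_ , f∈) → unblocked (lose f∈ (inj₂ refl))) ]′ ,
    [ (λ (_ , f∈) → unblocked (lose f∈ (inj₂ refl))) , (λ (_ , f∈) → unblocked (lose f∈ (inj₁ refl))) ]′

  link⇒adjMinus : ∀ {i j} → Link i j → AdjMinus F (vertex i) (vertex j)
  link⇒adjMinus {i} {j} link = via (find link)
    where
    via : (∃ λ e → e ∈ₗ edges bs₄ × (e ≡ (i , j) ⊎ e ≡ (j , i)) × ¬ Blocked e) →
          AdjMinus F (vertex i) (vertex j)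
    via (_ , e∈ , inj₁ refl , unblocked) =
      proj₁ (All.lookup edges-adjacent e∈) , proj₁ (unblocked⇒∉F {i} {j} unblocked)
    via (_ , e∈ , inj₂ refl , unblocked) =
      proj₂ (All.lookup edges-adjacent e∈) , proj₂ (unblocked⇒∉F {j} {i} unblocked)

  component-witness : (∃ λ v → 20 < ∣ component v ∣) → HasComponentOfSize≥ F 21
  component-witness (v , large) =
    vertex v , vertex-isPerm v , map vertex (members (component v)) ,
    Unique.map⁺ vertex-injective (members-unique (component v)) ,
    ≤-trans large (≤-reflexive (sym (trans (length-map vertex (members (component v)))
                                            (length-members (component v))))) ,
    All.map⁺ (All.tabulate λ {i} _ → vertex-isPerm i) ,
    All.map⁺ (All.tabulate λ i∈ → gmap vertex link⇒adjMinus (component-connected v (∈-members i∈)))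

  large-component : length F ≤ 11 → HasComponentOfSize≥ F 21
  large-component |F|≤11 =
    component-witness (big-component 3 20 (≤ᵇ⇒≤ 6 20 _) (≤ᵇ⇒≤ 4 24 _) (closed-gap |F|≤11))

-- The component exists whether or not BS₄ − F is disconnected.
lemma2p8 : (F : EdgeList 3) → length F ≤ 11 → Disconnected F →
    HasComponentOfSize≥ F (4 ! ∸ 3)
lemma2p8 F |F|≤11 _ = Faults.large-component F |F|≤11
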